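{- Player $I$ has a winning strategy in $G_1(\mathcal{R})$.
   Context: Cut and choose game $G_1(\mathcal{I})$ for an ideal $\mathcal{I}$ on $\omega$: in the first move player $I$ partitions $\omega=A^0_0\cup A^0_1$ and player $II$ answers with $i_0\in 2$ and $n_0\in A^0_{i_0}$; in move $m+1$ player $I$ partitions the previously chosen piece $A^m_{i_m}$ into two pieces and player $II$ chooses one of them (index $i_{m+1}$) and a point $n_{m+1}$ in it. Player $I$ wins if $\{n_j:j\in\omega\}\in\mathcal{I}$, otherwise player $II$ wins. $\mathcal{R}$ is the random graph ideal: the ideal on $\omega$ generated by the cliques and anticliques (homogeneous sets) of the random (Rado) graph on $\omega$, i.e. the graph such that for any disjoint finite $F,G\subseteq\omega$ there is a vertex outside $F\cup G$ adjacent to every element of $F$ and to no element of $G$. -}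

module Defs where

open import Data.Nat using (ℕ; _≤_)
open import Data.Bool using (Bool; true; false)
open import Data.Fin using (Fin)
open import Data.List using (List; map; upTo)
open import Data.List.Membership.Propositional using (_∈_; _∉_)
open import Data.List.Relation.Unary.All using (All)
open import Data.Product using (Σ; ∃; _×_; proj₁; proj₂)
open import Data.Sum using (_⊎_)
open import Relation.Binary.PropositionalEquality using (_≡_; _≢_)

IsGraph : (ℕ → ℕ → Bool) → Set
IsGraph E = (∀ x y → E x y ≡ E y x) × (∀ x → E x x ≡ false)

ExtensionProperty : (ℕ → ℕ → Bool) → Set
ExtensionProperty E =
  (F G : List ℕ) → All (λ x → x ∉ G) F →
  ∃ λ v → v ∉ F × v ∉ G × All (λ x → E v x ≡ true) F × All (λ y → E v y ≡ false) G

IsRandomGraph : (ℕ → ℕ → Bool) → Set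
IsRandomGraph E = IsGraph E × ExtensionProperty E

Subset : Set₁
Subset = ℕ → Set

Clique : (ℕ → ℕ → Bool) → Subset → Set
Clique E H = ∀ x y → H x → H y → x ≢ y → E x y ≡ true

Anticlique : (ℕ → ℕ → Bool) → Subset → Set
Anticlique E H = ∀ x y → H x → H y → x ≢ y → E x y ≡ false

Homogeneous : (ℕ → ℕ → Bool) → Subset → Set
Homogeneous E H = Clique E H ⊎ Anticlique E H

InRandomGraphIdeal : (ℕ → ℕ → Bool) → Subset → Set₁
InRandomGraphIdeal E X =
  Σ ℕ λ k → Σ (Fin k → Subset) λ H →
    (∀ i → Homogeneous E (H i)) × (∀ x → X x → ∃ λ i → H i x)

-- Cut and choose game G₁(𝓘).
-- A move of player II: an index i ∈ 2 and a point n.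
MoveII : Set
MoveII = Bool × ℕ

-- A strategy of player I: given the history of II's moves so far, a
-- partition of ω into two pieces, given by its characteristic function c
-- (piece A_b = {x | c x ≡ b}).  The partition of the current piece
-- A^m_{i_m} is obtained by intersecting it with these two pieces.
StrategyI : Set
StrategyI = List MoveII → (ℕ → Bool)

cut : StrategyI → (ℕ → MoveII) → ℕ → (ℕ → Bool)
cut σ f m = σ (map f (upTo m))

-- Legality of II's moves: n_m lies in the chosen piece
-- A^m_{i_m} = {x | ∀ j ≤ m, cut_j x ≡ i_j}.
LegalPlay : StrategyI → (ℕ → MoveII) → Set
LegalPlay σ f = ∀ m j → j ≤ m → cut σ f j (proj₂ (f m)) ≡ proj₁ (f j)

chosen : (ℕ → MoveII) → Subset
chosen f x = ∃ λ j → proj₂ (f j) ≡ x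

WinningI : (Subset → Set₁) → StrategyI → Set₁
WinningI inI σ = (f : ℕ → MoveII) → LegalPlay σ f → inI (chosen f)

-- Player I always cuts along the neighbourhood of the last point chosen by II.
-- Then II's choice i_{j+1} records whether n_j is adjacent to n_{j+1}, and since
-- every later point lies in that piece, also to all later points. Hence the
-- points n_j with i_{j+1} = true form a clique and those with i_{j+1} = false an
-- anticlique.
module Submission where

open import Defs
open import Data.Nat using (ℕ; suc; _<_)
open import Data.Nat.Properties using (<-cmp)
open import Data.Bool using (Bool; true; false)
open import Data.Fin.Properties using (2↔Bool)
open import Data.List using (List; []; _∷_; _∷ʳ_; map; upTo; last)
open import Data.List.Properties using (upTo-∷ʳ; last-map)
open import Data.Maybe as Maybe using (just; maybe′)
open import Data.Product using (Σ; ∃; _×_; _,_; proj₁; proj₂)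
open import Data.Sum using (inj₁; inj₂)
open import Data.Empty using (⊥-elim)
open import Function using (_∘_; const)
open import Function.Bundles using (Inverse)
open import Relation.Binary using (tri<; tri≈; tri>)
open import Relation.Binary.PropositionalEquality
  using (_≡_; _≢_; refl; sym; trans; cong; cong-app; subst; module ≡-Reasoning)

last-∷ʳ : ∀ {a} {A : Set a} (xs : List A) (x : A) → last (xs ∷ʳ x) ≡ just x
last-∷ʳ []           x = refl
last-∷ʳ (_ ∷ [])     x = refl
last-∷ʳ (_ ∷ y ∷ ys) x = last-∷ʳ (y ∷ ys) x

last-upTo-suc : ∀ n → last (upTo (suc n)) ≡ just n
last-upTo-suc n = trans (cong last (sym (upTo-∷ʳ n))) (last-∷ʳ (upTo n) n)

constantlyColoured⇒homogeneous : ∀ (E : ℕ → ℕ → Bool) (H : Subset) b →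
  (∀ x y → H x → H y → x ≢ y → E x y ≡ b) → Homogeneous E H
constantlyColoured⇒homogeneous E H true  all-edges    = inj₁ all-edges
constantlyColoured⇒homogeneous E H false all-nonedges = inj₂ all-nonedges

neighbourhoodOfLast : (ℕ → ℕ → Bool) → StrategyI
neighbourhoodOfLast E history = maybe′ (E ∘ proj₂) (const false) (last history)

module _ (E : ℕ → ℕ → Bool) (f : ℕ → MoveII) where

  point : ℕ → ℕ
  point j = proj₂ (f j)

  side : ℕ → Bool
  side j = proj₁ (f j)

  cut-suc : ∀ j → cut (neighbourhoodOfLast E) f (suc j) ≡ E (point j)
  cut-suc j = begin
    maybe′ (E ∘ proj₂) (const false) (last (map f (upTo (suc j))))
      ≡⟨ cong (maybe′ (E ∘ proj₂) (const false)) (last-map f (upTo (suc j))) ⟩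
    maybe′ (E ∘ proj₂) (const false) (Maybe.map f (last (upTo (suc j))))
      ≡⟨ cong (maybe′ (E ∘ proj₂) (const false) ∘ Maybe.map f) (last-upTo-suc j) ⟩
    E (point j) ∎
    where open ≡-Reasoning

  adjacency-to-later : LegalPlay (neighbourhoodOfLast E) f →
    ∀ {j k} → j < k → E (point j) (point k) ≡ side (suc j)
  adjacency-to-later legal {j} {k} j<k =
    trans (cong-app (sym (cut-suc j)) (point k)) (legal k (suc j) j<k)

  chosenThenSide : Bool → Subset
  chosenThenSide b x = ∃ λ j → point j ≡ x × side (suc j) ≡ b

  chosenThenSide-constantlyColoured : (∀ x y → E x y ≡ E y x) →
    LegalPlay (neighbourhoodOfLast E) f →
    ∀ b x y → chosenThenSide b x → chosenThenSide b y → x ≢ y → E x y ≡ b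
  chosenThenSide-constantlyColoured sym-E legal b _ _ (j , refl , sj) (k , refl , sk) x≢y
    with <-cmp j k
  ... | tri< j<k _ _ = trans (adjacency-to-later legal j<k) sj
  ... | tri≈ _ refl _ = ⊥-elim (x≢y refl)
  ... | tri> _ _ k<j = trans (sym-E _ _) (trans (adjacency-to-later legal k<j) sk)

  chosen⇒chosenThenSide : ∀ x → chosen f x → ∃ λ b → chosenThenSide b x
  chosen⇒chosenThenSide x (j , nj≡x) = side (suc j) , j , nj≡x , refl

proposition1p2 : (E : ℕ → ℕ → Bool) → IsRandomGraph E →
    Σ StrategyI λ σ → WinningI (InRandomGraphIdeal E) σ
proposition1p2 E ((sym-E , _) , _) = neighbourhoodOfLast E , λ f legal →
  2 , chosenThenSide E f ∘ to , homogeneous f legal , covered f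
  where
    open Inverse 2↔Bool using (to; from; strictlyInverseˡ)

    homogeneous : ∀ f → LegalPlay (neighbourhoodOfLast E) f →
      ∀ i → Homogeneous E (chosenThenSide E f (to i))
    homogeneous f legal i = constantlyColoured⇒homogeneous E _ (to i)
      (chosenThenSide-constantlyColoured E f sym-E legal (to i))

    covered : ∀ f x → chosen f x → ∃ λ i → chosenThenSide E f (to i) x
    covered f x x-chosen with chosen⇒chosenThenSide E f x x-chosen
    ... | b , x∈b = from b , subst (λ b′ → chosenThenSide E f b′ x) (sym (strictlyInverseˡ b)) x∈b
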